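{- Let $k\in\omega\setminus\{0,1\}$, let $\psi$ be a bounded complexity measure, let $A$ be a nontrivial closed class of decision tables from $\mathcal{M}_k^{\infty}$, and suppose the function $\mathcal{H}^{\infty}_{\psi,A}$ is everywhere defined. Then $\mathcal{H}^{\infty}_{\psi,A}$ is nondecreasing and $\mathcal{H}^{\infty}_{\psi,A}(0)=0$. Moreover: (a) if the function $\psi^d$ is bounded from above on $A$, then there is a nonnegative constant $c$ such that $\mathcal{H}^{\infty}_{\psi,A}(n)\le c$ for all $n\in\omega$; (b) if $\psi^d$ is not bounded from above on $A$, then there exists an infinite subset $D$ of $\omega$ such that $\mathcal{H}^{\infty}_{\psi,A}(n)\ge H_D(n)$ for all $n\in\omega$.
   Context: Let $\omega=\{0,1,2,\ldots\}$, let $\mathcal{P}(\omega)$ be the set of nonempty finite subsets of $\omega$, and for $k\in\omega\setminus\{0,1\}$ let $E_k=\{0,\ldots,k-1\}$. Let $P=\{f_i:i\in\omega\}$ be a set of attributes ($f_i\neq f_j$ iff $i\neq j$). $\mathcal{M}_k^{\infty}$ is the set of rectangular tables filled with numbers from $E_k$ whose rows are pairwise different, each row labeled with a set from $\mathcal{P}(\omega)$ (its set of decisions), and whose columns are labeled with pairwise different attributes from $P$; tables with no rows, all denoted $\Lambda$, also belong to $\mathcal{M}_k^{\infty}$. For $T\in\mathcal{M}_k^\infty$: $\Delta(T)$ is its set of rows, $\operatorname{At}(T)$ its set of column attributes, $\Pi(T)$ the intersection of the decision sets of all its rows (common decisions). For nonempty $T$, $\Omega_k(T)$ is the set of finite words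 (including the empty word $\lambda$) over the alphabet $\{(f_i,\delta):f_i\in\operatorname{At}(T),\delta\in E_k\}$; for $\alpha=(f_{i_1},\delta_1)\cdots(f_{i_m},\delta_m)$, $T\alpha$ is the subtable of rows having $\delta_1,\ldots,\delta_m$ in the columns labeled $f_{i_1},\ldots,f_{i_m}$ respectively ($T\lambda=T$). Operations: for $D\subseteq\operatorname{At}(T)$, $I(D,T)$ is obtained by deleting the columns labeled by attributes in $D$ and, in each group of rows equal on the remaining columns, keeping only the first one (with its decision set); for $\nu:E_k^{|\operatorname{At}(T)|}\to\mathcal{P}(\omega)$, $J(\nu,T)$ replaces the decision set of each row $\bar\delta$ by $\nu(\bar\delta)$. $[T]=\{J(\nu,I(D,T)):D\subseteq\operatorname{At}(T),\nu:E_k^{|\operatorname{At}(T)\setminus D|}\to\mathcal{P}(\omega)\}$, $[A]=\bigcup_{T\in A}[T]$; $A$ is a closed class if $[A]=A$, nontrivial if it contains a nonempty table. Decision trees: a $k$-decision tree is a finite directed rooted tree with at least two nodes, where the root and edges leaving it are unlabeled, terminal nodes are labeled with decisions from $\omega$, and every other node is labeled with an attribute from $P$, each edge leaving it labeled with a number from $E_k$. $\operatorname{At}(\Gamma)$ is the set of attributes labeling its nodes. For a complete path $\tau=v_1,d_1,\ldots,v_m,d_m,v_{m+1}$ (root to a terminal node), $\pi(\tau)=\lambda$ if $m=1$, otherwise $\pi(\tau)=(f_{i_2},\delta_2)\cdots(f_{i_m},\delta_m)$ where $v_j$ is labeled $f_{i_j}$ and $d_j$ is labeled $\delta_j$; $T(\tau)=T\pi(\tau)$.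 For nonempty $T$, a nondeterministic decision tree for $T$ is a $k$-decision tree $\Gamma$ with $\operatorname{At}(\Gamma)\subseteq\operatorname{At}(T)$ such that each row of $T$ belongs to $T(\tau)$ for some complete path $\tau$, and for each complete path $\tau$ either $T(\tau)=\Lambda$ or the decision at its terminal node lies in $\Pi(T(\tau))$. A deterministic decision tree for $T$ is a nondeterministic one in which exactly one edge leaves the root and edges leaving any other nonterminal node have pairwise different labels. Complexity measures: $P^*$ is the set of finite words over $P$ (including $\lambda$). A partially bounded complexity measure is $\psi:P^*\to\omega$ with: $\psi(\alpha)=0$ iff $\alpha=\lambda$; $\psi$ invariant under permutation of letters; $\psi(\alpha_1)\le\psi(\alpha_1\alpha_2)$; $\psi(\alpha_1\alpha_2)\le\psi(\alpha_1)+\psi(\alpha_2)$. It is bounded if also $\psi(\alpha)\ge|\alpha|$ for all $\alpha$. Extend $\psi$ to words over pairs by $\psi((f_{i_1},\delta_1)\cdots(f_{i_m},\delta_m))=\psi(f_{i_1}\cdots f_{i_m})$, $\psi(\lambda)=0$, and to trees by $\psi(\Gamma)=\max_\tau\psi(\pi(\tau))$ over complete paths. For nonempty $T$, $\psi^d(T)$ ($\psi^a(T)$) is the minimum of $\psi(\Gamma)$ over deterministic (nondeterministic) decision trees for $T$; $\psi^d(\Lambda)=\psi^a(\Lambda)=0$. $\mathcal{H}^{\infty}_{\psi,A}(n)$ is undefined if $\{\psi^d(T):T\in A,\psi^a(T)\le n\}$ is infinite and equals its maximum otherwise. For an infinite set $D=\{n_i:i\in\omega\}\subseteq\omega$ with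 $n_i<n_{i+1}$, $H_D:\omega\to\omega$ is defined by $H_D(n)=0$ if $n<n_0$ and $H_D(n)=n_i$ if $n_i\le n<n_{i+1}$. -}

module Defs where

open import Data.Nat using (ℕ; zero; suc; _+_; _≤_; _<_; _⊔_)
open import Data.Nat.Properties using () renaming (_≟_ to _≟ℕ_)
open import Data.Bool using (Bool; true; false)
open import Data.Fin using (Fin)
open import Data.Fin.Properties using (any?) renaming (_≟_ to _≟F_)
open import Data.Vec using (Vec; []; _∷_; lookup)
import Data.Vec as Vec
open import Data.Vec.Properties using (≡-dec)
import Data.Vec.Membership.Propositional as VecMem
open import Data.List using (List; []; _∷_; _++_; map; foldr; length; filter)
open import Data.List.NonEmpty using (List⁺; _∷_; toList; head; tail)
open import Data.List.Membership.Propositional using (_∈_)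
open import Data.List.Relation.Unary.All using (All; all?)
open import Data.List.Relation.Unary.Any using (Any)
import Data.List.Relation.Unary.Any as AnyL
open import Data.List.Relation.Unary.AllPairs using (AllPairs)
open import Data.List.Relation.Binary.Permutation.Propositional using (_↭_)
open import Data.Product using (Σ; ∃; ∃-syntax; _×_; _,_; proj₁; proj₂)
open import Data.Product.Properties using () 
open import Relation.Nullary.Decidable using (Dec; yes; no; _×-dec_)
open import Relation.Nullary using (¬_)
open import Data.Sum using (_⊎_)
open import Data.Unit using (⊤)
open import Relation.Binary.PropositionalEquality using (_≡_; _≢_)

-- Conventions
--  * attribute f_i is represented by the natural number i;
--  * decisions are natural numbers;
--  * a nonempty finite set of decisions (element of 𝒫(ω)) is represented
--    by a nonempty list (List⁺ ℕ), read as the set of its entries;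
--  * E_k is Fin k.

DecSet : Set
DecSet = List⁺ ℕ

_∈D_ : ℕ → DecSet → Set
d ∈D s = d ∈ toList s

record Table (k : ℕ) : Set where
  constructor mkTable
  field
    n     : ℕ
    attrs : Vec ℕ n
    rows  : List (Vec (Fin k) n × DecSet)
open Table public

-- Well-formedness (membership in 𝓜_k^∞): column attributes pairwise
-- different, rows (as tuples) pairwise different.
WF : ∀ {k} → Table k → Set
WF T = AllPairs _≢_ (Vec.toList (attrs T))
     × AllPairs (λ r s → proj₁ r ≢ proj₁ s) (rows T)

NonEmptyT : ∀ {k} → Table k → Set
NonEmptyT T = rows T ≢ []

-- A column mask: true = keep the column, false = delete it.
-- The set D of the paper is the set of attributes of columns marked false.
count : ∀ {n} → Vec Bool n → ℕ
count [] = 0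
count (true ∷ m) = suc (count m)
count (false ∷ m) = count m

select : ∀ {A : Set} {n} (m : Vec Bool n) → Vec A n → Vec A (count m)
select [] [] = []
select (true ∷ m) (x ∷ xs) = x ∷ select m xs
select (false ∷ m) (x ∷ xs) = select m xs

dedupFirst : ∀ {k m} → List (Vec (Fin k) m) → List (Vec (Fin k) m × DecSet)
           → List (Vec (Fin k) m × DecSet)
dedupFirst seen [] = []
dedupFirst seen ((v , ds) ∷ rs) with AnyL.any? (≡-dec _≟F_ v) seen
... | yes _ = dedupFirst seen rs
... | no _  = (v , ds) ∷ dedupFirst (v ∷ seen) rs

I : ∀ {k} (T : Table k) → Vec Bool (n T) → Table k
I T m = mkTable (count m) (select m (attrs T))
          (dedupFirst [] (map (λ r → select m (proj₁ r) , proj₂ r) (rows T)))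

J : ∀ {k} (T : Table k) → (Vec (Fin k) (n T) → DecSet) → Table k
J T ν = mkTable (n T) (attrs T) (map (λ r → proj₁ r , ν (proj₁ r)) (rows T))

-- A is a closed class of tables from 𝓜_k^∞: all its members are tables,
-- and [A] ⊆ A (A ⊆ [A] holds automatically).
ClosedClass : ∀ {k} → (Table k → Set) → Set
ClosedClass {k} A =
  (∀ T → A T → WF T) ×
  (∀ T → A T → (m : Vec Bool (n T)) (ν : Vec (Fin k) (count m) → DecSet) →
     A (J (I T m) ν))

Nontrivial : ∀ {k} → (Table k → Set) → Set
Nontrivial A = ∃[ T ] (A T × NonEmptyT T)

Word : ℕ → Set
Word k = List (ℕ × Fin k)

SatL : ∀ {k} (T : Table k) → Vec (Fin k) (n T) → ℕ × Fin k → Set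
SatL T v (f , δ) = ∃[ i ] (lookup (attrs T) i ≡ f × lookup v i ≡ δ)

satL? : ∀ {k} (T : Table k) (v : Vec (Fin k) (n T)) (p : ℕ × Fin k) → Dec (SatL T v p)
satL? T v (f , δ) = any? (λ i → (lookup (attrs T) i ≟ℕ f) ×-dec (lookup v i ≟F δ))

sub : ∀ {k} (T : Table k) → Word k → Table k
sub T α = mkTable (n T) (attrs T)
  (filter (λ r → all? (satL? T (proj₁ r)) α) (rows T))

_∈Π_ : ∀ {k} → ℕ → Table k → Set
d ∈Π T = All (λ r → d ∈D proj₂ r) (rows T)

data Node (k : ℕ) : Set where
  leaf  : ℕ → Node k
  query : ℕ → List⁺ (Fin k × Node k) → Node k

-- a tree: the unlabelled root with its (nonempty) list of children
Tree : ℕ → Set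
Tree k = List⁺ (Node k)

mutual
  pathsN : ∀ {k} → Node k → List (Word k × ℕ)
  pathsN (leaf d) = ([] , d) ∷ []
  pathsN (query f (e ∷ es)) = pathsE f e ++ pathsEs f es

  pathsE : ∀ {k} → ℕ → Fin k × Node k → List (Word k × ℕ)
  pathsE f (δ , c) = map (λ p → ((f , δ) ∷ proj₁ p) , proj₂ p) (pathsN c)

  pathsEs : ∀ {k} → ℕ → List (Fin k × Node k) → List (Word k × ℕ)
  pathsEs f [] = []
  pathsEs f (e ∷ es) = pathsE f e ++ pathsEs f es

pathsNs : ∀ {k} → List (Node k) → List (Word k × ℕ)
pathsNs [] = []
pathsNs (c ∷ cs) = pathsN c ++ pathsNs cs

paths : ∀ {k} → Tree k → List (Word k × ℕ)
paths Γ = pathsNs (toList Γ)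

mutual
  attrsN : ∀ {k} → Node k → List ℕ
  attrsN (leaf _) = []
  attrsN (query f ((δ , c) ∷ es)) = f ∷ (attrsN c ++ attrsEs es)

  attrsEs : ∀ {k} → List (Fin k × Node k) → List ℕ
  attrsEs [] = []
  attrsEs ((δ , c) ∷ es) = attrsN c ++ attrsEs es

attrsNs : ∀ {k} → List (Node k) → List ℕ
attrsNs [] = []
attrsNs (c ∷ cs) = attrsN c ++ attrsNs cs

attrsT : ∀ {k} → Tree k → List ℕ
attrsT Γ = attrsNs (toList Γ)

mutual
  DetN : ∀ {k} → Node k → Set
  DetN (leaf _) = ⊤
  DetN (query f ((δ , c) ∷ es)) =
    AllPairs _≢_ (δ ∷ map proj₁ es) × DetN c × DetEs es

  DetEs : ∀ {k} → List (Fin k × Node k) → Set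
  DetEs [] = ⊤
  DetEs ((δ , c) ∷ es) = DetN c × DetEs es

NDTreeFor : ∀ {k} → Table k → Tree k → Set
NDTreeFor T Γ =
  All (λ f → f VecMem.∈ attrs T) (attrsT Γ) ×
  (∀ r → r ∈ rows T → Any (λ p → r ∈ rows (sub T (proj₁ p))) (paths Γ)) ×
  All (λ p → rows (sub T (proj₁ p)) ≡ [] ⊎ proj₂ p ∈Π sub T (proj₁ p)) (paths Γ)

DetTreeFor : ∀ {k} → Table k → Tree k → Set
DetTreeFor T Γ = NDTreeFor T Γ × tail Γ ≡ [] × DetN (head Γ)

-- Complexity measures (words over P are lists of attribute indices)

IsPartiallyBounded : (List ℕ → ℕ) → Set
IsPartiallyBounded ψ =
  (∀ α → ψ α ≡ 0 → α ≡ []) × ψ [] ≡ 0 ×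
  (∀ α β → α ↭ β → ψ α ≡ ψ β) ×
  (∀ α β → ψ α ≤ ψ (α ++ β)) ×
  (∀ α β → ψ (α ++ β) ≤ ψ α + ψ β)

IsBoundedMeasure : (List ℕ → ℕ) → Set
IsBoundedMeasure ψ = IsPartiallyBounded ψ × (∀ α → length α ≤ ψ α)

ψW : ∀ {k} → (List ℕ → ℕ) → Word k → ℕ
ψW ψ α = ψ (map proj₁ α)

ψT : ∀ {k} → (List ℕ → ℕ) → Tree k → ℕ
ψT ψ Γ = foldr _⊔_ 0 (map (λ p → ψW ψ (proj₁ p)) (paths Γ))

PsiD : ∀ {k} → (List ℕ → ℕ) → Table k → ℕ → Set
PsiD ψ T m =
  (rows T ≡ [] × m ≡ 0) ⊎
  (NonEmptyT T × (∃[ Γ ] (DetTreeFor T Γ × ψT ψ Γ ≡ m)) ×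
     (∀ Γ → DetTreeFor T Γ → m ≤ ψT ψ Γ))

PsiA : ∀ {k} → (List ℕ → ℕ) → Table k → ℕ → Set
PsiA ψ T m =
  (rows T ≡ [] × m ≡ 0) ⊎
  (NonEmptyT T × (∃[ Γ ] (NDTreeFor T Γ × ψT ψ Γ ≡ m)) ×
     (∀ Γ → NDTreeFor T Γ → m ≤ ψT ψ Γ))

HVal : ∀ {k} → (List ℕ → ℕ) → (Table k → Set) → ℕ → ℕ → Set
HVal ψ A n m =
  (∃[ T ] (A T × (∃[ a ] (PsiA ψ T a × a ≤ n)) × PsiD ψ T m)) ×
  (∀ T → A T → ∀ a d → PsiA ψ T a → a ≤ n → PsiD ψ T d → d ≤ m)

PsiDBounded : ∀ {k} → (List ℕ → ℕ) → (Table k → Set) → Set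
PsiDBounded ψ A = ∃[ c ] (∀ T → A T → ∀ m → PsiD ψ T m → m ≤ c)

PsiDUnbounded : ∀ {k} → (List ℕ → ℕ) → (Table k → Set) → Set
PsiDUnbounded ψ A = ∀ c → ∃[ T ] (A T × ∃[ m ] (PsiD ψ T m × c < m))

-- infinite D = {d 0 < d 1 < ...} given by a strictly increasing sequence;
-- H_D(n) ≡ v
HD : (ℕ → ℕ) → ℕ → ℕ → Set
HD d n v = (n < d 0 × v ≡ 0) ⊎ (∃[ i ] (d i ≤ n × n < d (suc i) × v ≡ d i))

{-# OPTIONS --safe #-}
module Submission where

-- A table with ψ^a(T) = 0 has a nondeterministic tree all of whose paths are
-- empty (ψ α = 0 forces α = []), so some decision is common to all its rows and a
-- single leaf is a deterministic tree for it; hence 𝓗(0) = 0.  Monotonicity and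
-- (a) hold because 𝓗(n) is a maximum over a set growing with n.  For (b),
-- ψ^a(T) ≤ ψ^d(T) gives m ≤ 𝓗(m) for every value m of ψ^d on A, and iterating
-- "take a value of ψ^d above the previous one" produces D.
--
-- The substance is that ψ^a(T) is attained at all.  A path α ending in decision d
-- that decides a row r may be replaced by the path reading r on exactly the columns
-- whose attributes α queries: by permutation invariance and monotonicity of ψ it
-- is no more complex, and every row following it also follows α, so d stays
-- correct.  Each row has finitely many such candidate paths, and a root with one
-- cheapest chain per row is a nondeterministic tree of minimal complexity.

open import Defs
open import Data.Nat using (ℕ; zero; suc; _≤_; _<_; _⊔_; z≤n)
open import Data.Nat.Properties
  using (module ≤-Reasoning; ≤-trans; ≤-reflexive; n≤0⇒n≡0; ⊔-lub; m≤m⊔n; m≤n⇒m≤o⊔n; ⊔-identityʳ)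
open import Data.Bool using (true; false)
open import Data.Fin using (Fin)
open import Data.Vec using (Vec; _∷_; lookup)
import Data.Vec as Vec
open import Data.Vec.Membership.Propositional using () renaming (_∈_ to _∈ᵥ_)
open import Data.Vec.Membership.Propositional.Properties
  using (∈-toList⁺) renaming (∈-lookup to ∈ᵥ-lookup)
open import Data.List
  using (List; []; _∷_; _++_; map; foldr; filter; concatMap; cartesianProduct; allFin)
open import Data.List.Properties using (map-∘; ++-identityʳ; foldr-preservesᵇ)
open import Data.List.NonEmpty using (_∷_; toList)
open import Data.List.Extrema.Nat using (argmin; argmin-sel; f[argmin]≤f[⊤]; f[argmin]≤f[xs])
open import Data.List.Membership.Propositional using (_∈_; lose; find)
open import Data.List.Membership.Propositional.Properties
  using ( ∈-++⁺ˡ; ∈-++⁺ʳ; ∈-map⁺; ∈-map⁻; ∈-filter⁺; ∈-filter⁻; ∈-cartesianProduct⁺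
        ; ∈-concatMap⁺; ∈-concatMap⁻; ∈-∃++; ∈-allFin)
open import Data.List.Membership.DecPropositional Data.Nat.Properties._≟_ using (_∈?_)
open import Data.List.Relation.Binary.Subset.Propositional using (_⊆_)
open import Data.List.Relation.Binary.Permutation.Propositional
  using (_↭_; ↭-refl; ↭-prep; ↭-trans; ↭-sym)
open import Data.List.Relation.Binary.Permutation.Propositional.Properties
  using (shift; ∈-resp-↭)
open import Data.List.Relation.Unary.All using (All; []; _∷_; all?)
import Data.List.Relation.Unary.All as All
open import Data.List.Relation.Unary.All.Properties
  using (anti-mono; concat⁺) renaming (map⁺ to All-map⁺)
open import Data.List.Relation.Unary.Any using (Any; here; there)
open import Data.List.Relation.Unary.Any.Properties using (¬Any[])
import Data.List.Relation.Unary.Any as Any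
open import Data.List.Relation.Unary.AllPairs using (AllPairs; _∷_)
open import Data.List.Relation.Unary.Unique.Propositional using (Unique)
import Data.List.Relation.Unary.Unique.Propositional.Properties as Unique
open import Data.Product using (∃; ∃₂; ∃-syntax; _×_; _,_; proj₁; proj₂; uncurry)
open import Data.Sum using (_⊎_; inj₁; inj₂)
open import Data.Empty using (⊥-elim)
open import Data.Unit using (tt)
open import Function using (_∘_)
open import Relation.Nullary using (Dec; does)
open import Relation.Unary using (Decidable)
open import Relation.Binary.PropositionalEquality
  using (_≡_; _≢_; refl; sym; trans; cong; subst; ≢-sym)

nonempty-∈ : ∀ {A : Set} {xs : List A} → xs ≢ [] → ∃ (_∈ xs)
nonempty-∈ {xs = []} xs≢[] = ⊥-elim (xs≢[] refl)
nonempty-∈ {xs = x ∷ _} _ = x , here refl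

map-≡[] : ∀ {A B : Set} {f : A → B} xs → map f xs ≡ [] → xs ≡ []
map-≡[] [] _ = refl

Any⇒≢[] : ∀ {A : Set} {P : A → Set} {xs} → Any P xs → xs ≢ []
Any⇒≢[] p refl = ¬Any[] p

sublists : ∀ {A : Set} → List A → List (List A)
sublists [] = [] ∷ []
sublists (x ∷ xs) = map (x ∷_) (sublists xs) ++ sublists xs

filter∈sublists : ∀ {A : Set} {P : A → Set} (P? : Decidable P) xs → filter P? xs ∈ sublists xs
filter∈sublists P? [] = here refl
filter∈sublists P? (x ∷ xs) with does (P? x)
... | true  = ∈-++⁺ˡ (∈-map⁺ (x ∷_) (filter∈sublists P? xs))
... | false = ∈-++⁺ʳ _ (filter∈sublists P? xs)

minimal : ∀ {A : Set} → (A → ℕ) → List A → List A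
minimal f [] = []
minimal f (x ∷ xs) = argmin f x xs ∷ []

minimal-⊆ : ∀ {A : Set} (f : A → ℕ) xs → minimal f xs ⊆ xs
minimal-⊆ f (x ∷ xs) (here refl) with argmin-sel f x xs
... | inj₁ argmin≡x = here argmin≡x
... | inj₂ argmin∈xs = there argmin∈xs

minimal-≤ : ∀ {A : Set} (f : A → ℕ) {xs y} → y ∈ xs → All (λ x → f x ≤ f y) (minimal f xs)
minimal-≤ f {x ∷ xs} (here refl) = f[argmin]≤f[⊤] {f = f} x xs ∷ []
minimal-≤ f {x ∷ xs} (there y∈xs) = All.lookup (f[argmin]≤f[xs] {f = f} x xs) y∈xs ∷ []

minimal-nonempty : ∀ {A : Set} (f : A → ℕ) {xs y} → y ∈ xs → ∃ (_∈ minimal f xs)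
minimal-nonempty f {x ∷ xs} _ = argmin f x xs , here refl

unique-⊆⇒↭++ : ∀ {A : Set} {xs ys : List A} → Unique xs → xs ⊆ ys → ∃ λ zs → ys ↭ xs ++ zs
unique-⊆⇒↭++ {xs = []} {ys} _ _ = ys , ↭-refl
unique-⊆⇒↭++ {xs = x ∷ xs} (x∉xs ∷ xs-unique) xs⊆ys
  with ys₁ , ys₂ , refl ← ∈-∃++ (xs⊆ys (here refl))
  with zs , ↭xs++zs ← unique-⊆⇒↭++ xs-unique (λ w∈xs →
         Any.tail (≢-sym (All.lookup x∉xs w∈xs)) (∈-resp-↭ (shift x ys₁ ys₂) (xs⊆ys (there w∈xs))))
  = zs , ↭-trans (shift x ys₁ ys₂) (↭-prep x ↭xs++zs)

≤-max : ∀ {x} xs → x ∈ xs → x ≤ foldr _⊔_ 0 xs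
≤-max (y ∷ ys) (here refl) = m≤m⊔n y _
≤-max (y ∷ ys) (there x∈ys) = m≤n⇒m≤o⊔n y (≤-max ys x∈ys)

lookup-injective : ∀ {A : Set} {n} (v : Vec A n) → AllPairs _≢_ (Vec.toList v) →
  ∀ i j → lookup v i ≡ lookup v j → i ≡ j
lookup-injective (x ∷ v) _ Fin.zero Fin.zero _ = refl
lookup-injective (x ∷ v) (x∉v ∷ _) Fin.zero (Fin.suc j) eq =
  ⊥-elim (All.lookup x∉v (∈-toList⁺ (∈ᵥ-lookup j v)) eq)
lookup-injective (x ∷ v) (x∉v ∷ _) (Fin.suc i) Fin.zero eq =
  ⊥-elim (All.lookup x∉v (∈-toList⁺ (∈ᵥ-lookup i v)) (sym eq))
lookup-injective (x ∷ v) (_ ∷ v-unique) (Fin.suc i) (Fin.suc j) eq =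
  cong Fin.suc (lookup-injective v v-unique i j eq)

module _ {k : ℕ} (ψ : List ℕ → ℕ) where

  ψT-path : ∀ (Γ : Tree k) {p} → p ∈ paths Γ → ψW ψ (proj₁ p) ≤ ψT ψ Γ
  ψT-path Γ p∈ = ≤-max _ (∈-map⁺ (ψW ψ ∘ proj₁) p∈)

  ψT-lub : ∀ (Γ : Tree k) {b} → (∀ {p} → p ∈ paths Γ → ψW ψ (proj₁ p) ≤ b) → ψT ψ Γ ≤ b
  ψT-lub Γ {b} bound = foldr-preservesᵇ {P = _≤ b} ⊔-lub z≤n (All-map⁺ (All.tabulate bound))

chain : ∀ {k} → Word k → ℕ → Node k
chain [] d = leaf d
chain ((f , δ) ∷ w) d = query f ((δ , chain w d) ∷ [])

pathsN-chain : ∀ {k} (w : Word k) d → pathsN (chain w d) ≡ (w , d) ∷ []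
pathsN-chain [] d = refl
pathsN-chain ((f , δ) ∷ w) d rewrite pathsN-chain w d = refl

attrsN-chain : ∀ {k} (w : Word k) d → attrsN (chain w d) ≡ map proj₁ w
attrsN-chain [] d = refl
attrsN-chain ((f , δ) ∷ w) d rewrite ++-identityʳ (attrsN (chain w d)) | attrsN-chain w d = refl

module _ {k : ℕ} where

  pathsNs-chains : (L : List (Word k × ℕ)) → pathsNs (map (uncurry chain) L) ≡ L
  pathsNs-chains [] = refl
  pathsNs-chains ((w , d) ∷ L) rewrite pathsN-chain w d | pathsNs-chains L = refl

  attrsNs-chains : (L : List (Word k × ℕ)) →
    attrsNs (map (uncurry chain) L) ≡ concatMap (map proj₁ ∘ proj₁) L
  attrsNs-chains [] = refl
  attrsNs-chains ((w , d) ∷ L) rewrite attrsN-chain w d | attrsNs-chains L = refl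

  pathTree : (L : List (Word k × ℕ)) → L ≢ [] → Tree k
  pathTree [] L≢[] = ⊥-elim (L≢[] refl)
  pathTree (p ∷ L) _ = uncurry chain p ∷ map (uncurry chain) L

  paths-pathTree : ∀ L (L≢[] : L ≢ []) → paths (pathTree L L≢[]) ≡ L
  paths-pathTree [] L≢[] = ⊥-elim (L≢[] refl)
  paths-pathTree (p ∷ L) _ = pathsNs-chains (p ∷ L)

  attrsT-pathTree : ∀ L (L≢[] : L ≢ []) →
    attrsT (pathTree L L≢[]) ≡ concatMap (map proj₁ ∘ proj₁) L
  attrsT-pathTree [] L≢[] = ⊥-elim (L≢[] refl)
  attrsT-pathTree (p ∷ L) _ = attrsNs-chains (p ∷ L)

module _ {k : ℕ} (T : Table k) where

  Row : Set
  Row = Vec (Fin k) (n T) × DecSet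

  sub⁺ : ∀ {α r} → r ∈ rows T → All (SatL T (proj₁ r)) α → r ∈ rows (sub T α)
  sub⁺ {α} = ∈-filter⁺ (λ r → all? (satL? T (proj₁ r)) α)

  sub⁻ : ∀ {α r} → r ∈ rows (sub T α) → r ∈ rows T × All (SatL T (proj₁ r)) α
  sub⁻ {α} = ∈-filter⁻ (λ r → all? (satL? T (proj₁ r)) α)

  sub-⊆ : ∀ {α β} → (∀ {v} → All (SatL T v) α → All (SatL T v) β) →
    rows (sub T α) ⊆ rows (sub T β)
  sub-⊆ {α} α⇒β {r} r∈ = sub⁺ (proj₁ (sub⁻ {α} r∈)) (α⇒β {proj₁ r} (proj₂ (sub⁻ {α} r∈)))

  Decides : Row → Word k × ℕ → Set
  Decides r p = r ∈ rows (sub T (proj₁ p)) × proj₂ p ∈Π sub T (proj₁ p)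

  deciding-path : ∀ Γ {r} → NDTreeFor T Γ → r ∈ rows T → ∃ λ p → p ∈ paths Γ × Decides r p
  deciding-path Γ {r} (_ , covers , correct) r∈ with find (covers r r∈)
  ... | p , p∈ , r∈sub with All.lookup correct p∈
  ... | inj₁ no-rows = ⊥-elim (¬Any[] (subst (r ∈_) no-rows r∈sub))
  ... | inj₂ common = p , p∈ , r∈sub , common

-- Existence of an optimal nondeterministic decision tree

module OptimalTree {k : ℕ} (ψ : List ℕ → ℕ)
  (ψ-↭ : ∀ α β → α ↭ β → ψ α ≡ ψ β) (ψ-++ : ∀ α β → ψ α ≤ ψ (α ++ β))
  (T : Table k) (attrs-unique : AllPairs _≢_ (Vec.toList (attrs T))) where

  restrict : Vec (Fin k) (n T) → List (Fin (n T)) → Word k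
  restrict v is = map (λ i → lookup (attrs T) i , lookup v i) is

  restrict-sat : ∀ v is → All (SatL T v) (restrict v is)
  restrict-sat v is = All-map⁺ (All.tabulate (λ {i} _ → i , refl , refl))

  restrict-attrs : ∀ v is → All (_∈ᵥ attrs T) (map proj₁ (restrict v is))
  restrict-attrs v is = All-map⁺ (All-map⁺ (All.tabulate (λ {i} _ → ∈ᵥ-lookup i (attrs T))))

  occurs? : ∀ (α : Word k) i → Dec (lookup (attrs T) i ∈ map proj₁ α)
  occurs? α i = lookup (attrs T) i ∈? map proj₁ α

  occurring : Word k → List (Fin (n T))
  occurring α = filter (occurs? α) (allFin (n T))

  ∈-occurring⁺ : ∀ {α} i → lookup (attrs T) i ∈ map proj₁ α → i ∈ occurring α
  ∈-occurring⁺ {α} i = ∈-filter⁺ (occurs? α) {xs = allFin (n T)} (∈-allFin i)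

  restrict-occurring-sat : ∀ {v s α} → All (SatL T v) α →
    All (SatL T s) (restrict v (occurring α)) → All (SatL T s) α
  restrict-occurring-sat {v} {s} {α} v-sat s-sat = All.tabulate sat
    where
    sat : ∀ {l} → l ∈ α → SatL T s l
    sat {f , δ} l∈α with All.lookup v-sat l∈α
    ... | i , refl , refl
      with j , atⱼ≡atᵢ , sⱼ≡vᵢ ← All.lookup s-sat (∈-map⁺ _ (∈-occurring⁺ i (∈-map⁺ proj₁ l∈α)))
      with refl ← lookup-injective (attrs T) attrs-unique j i atⱼ≡atᵢ
      = i , refl , sⱼ≡vᵢ

  attrs-occurring-unique : ∀ α → Unique (map (lookup (attrs T)) (occurring α))
  attrs-occurring-unique α = Unique.map⁺ (lookup-injective (attrs T) attrs-unique _ _)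
                               (Unique.filter⁺ (occurs? α) (Unique.allFin⁺ (n T)))

  attrs-occurring-⊆ : ∀ α → map (lookup (attrs T)) (occurring α) ⊆ map proj₁ α
  attrs-occurring-⊆ α f∈ with i , i∈ , refl ← ∈-map⁻ _ f∈ =
    proj₂ (∈-filter⁻ (occurs? α) {xs = allFin (n T)} i∈)

  ψ-restrict-occurring : ∀ v α → ψW ψ (restrict v (occurring α)) ≤ ψW ψ α
  ψ-restrict-occurring v α
    with zs , α↭ ← unique-⊆⇒↭++ (attrs-occurring-unique α) (attrs-occurring-⊆ α) = begin
      ψ (map proj₁ (restrict v (occurring α)))       ≡⟨ cong ψ (sym (map-∘ (occurring α))) ⟩
      ψ (map (lookup (attrs T)) (occurring α))       ≤⟨ ψ-++ _ zs ⟩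
      ψ (map (lookup (attrs T)) (occurring α) ++ zs) ≡⟨ ψ-↭ _ _ (↭-sym α↭) ⟩
      ψ (map proj₁ α)                                ∎
    where open ≤-Reasoning

  Candidate : Set
  Candidate = List (Fin (n T)) × ℕ

  toPath : Row T → Candidate → Word k × ℕ
  toPath r x = restrict (proj₁ r) (proj₁ x) , proj₂ x

  cost : Row T → Candidate → ℕ
  cost r x = ψW ψ (proj₁ (toPath r x))

  Good : Row T → Candidate → Set
  Good r x = proj₂ x ∈Π sub T (proj₁ (toPath r x))

  good? : ∀ r x → Dec (Good r x)
  good? r x = all? (λ s → proj₂ x ∈? toList (proj₂ s)) _

  allCandidates : Row T → List Candidate
  allCandidates r = cartesianProduct (sublists (allFin (n T))) (toList (proj₂ r))

  candidates : Row T → List Candidate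
  candidates r = filter (good? r) (allCandidates r)

  candidate-from-tree : ∀ Γ {r} → NDTreeFor T Γ → r ∈ rows T →
    ∃ λ x → x ∈ candidates r × cost r x ≤ ψT ψ Γ
  candidate-from-tree Γ {r} nd r∈ with (α , d) , p∈ , r∈sub , common ← deciding-path T Γ nd r∈ =
    (occurring α , d) , x∈ , ≤-trans (ψ-restrict-occurring (proj₁ r) α) (ψT-path ψ Γ p∈)
    where
    r-sat : All (SatL T (proj₁ r)) α
    r-sat = proj₂ (sub⁻ T {α} r∈sub)
    x∈ : (occurring α , d) ∈ candidates r
    x∈ = ∈-filter⁺ (good? r) {xs = allCandidates r}
           (∈-cartesianProduct⁺ (filter∈sublists (occurs? α) (allFin (n T))) (All.lookup common r∈sub))
           (anti-mono (sub-⊆ T (λ {s} → restrict-occurring-sat {proj₁ r} {s} r-sat)) common)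

  optimalPathsOf : Row T → List (Word k × ℕ)
  optimalPathsOf r = map (toPath r) (minimal (cost r) (candidates r))

  optimalPaths : List (Word k × ℕ)
  optimalPaths = concatMap optimalPathsOf (rows T)

  ∈-optimalPaths⁻ : ∀ {p} → p ∈ optimalPaths →
    ∃₂ λ r x → r ∈ rows T × x ∈ minimal (cost r) (candidates r) × p ≡ toPath r x
  ∈-optimalPaths⁻ p∈
    with r , r∈ , p∈r ← find (∈-concatMap⁻ optimalPathsOf p∈)
    with x , x∈ , refl ← ∈-map⁻ (toPath r) p∈r
    = r , x , r∈ , x∈ , refl

  optimalPath-cost : ∀ Γ {p} → NDTreeFor T Γ → p ∈ optimalPaths → ψW ψ (proj₁ p) ≤ ψT ψ Γ
  optimalPath-cost Γ nd p∈
    with r , x , r∈ , x∈ , refl ← ∈-optimalPaths⁻ p∈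
    with y , y∈ , y-cost ← candidate-from-tree Γ nd r∈
    = ≤-trans (All.lookup (minimal-≤ (cost r) y∈) x∈) y-cost

  optimalPath-correct : ∀ {p} → p ∈ optimalPaths →
    rows (sub T (proj₁ p)) ≡ [] ⊎ proj₂ p ∈Π sub T (proj₁ p)
  optimalPath-correct p∈ with r , x , _ , x∈ , refl ← ∈-optimalPaths⁻ p∈ =
    inj₂ (proj₂ (∈-filter⁻ (good? r) {xs = allCandidates r} (minimal-⊆ (cost r) _ x∈)))

  optimalPath-attrs : ∀ {p} → p ∈ optimalPaths → All (_∈ᵥ attrs T) (map proj₁ (proj₁ p))
  optimalPath-attrs p∈ with r , x , _ , _ , refl ← ∈-optimalPaths⁻ p∈ =
    restrict-attrs (proj₁ r) (proj₁ x)

  optimalPaths-cover : ∀ Γ {r} → NDTreeFor T Γ → r ∈ rows T →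
    Any (λ p → r ∈ rows (sub T (proj₁ p))) optimalPaths
  optimalPaths-cover Γ {r} nd r∈
    with y , y∈ , _ ← candidate-from-tree Γ nd r∈
    with x , x∈ ← minimal-nonempty (cost r) y∈
    = lose (∈-concatMap⁺ optimalPathsOf (lose r∈ (∈-map⁺ (toPath r) x∈)))
           (sub⁺ T r∈ (restrict-sat (proj₁ r) (proj₁ x)))

  psiA-attained : ∀ Γ₀ → NonEmptyT T → NDTreeFor T Γ₀ → ∃[ a ] (PsiA ψ T a × a ≤ ψT ψ Γ₀)
  psiA-attained Γ₀ ne nd₀ =
    ψT ψ Γ* , inj₂ (ne , (Γ* , Γ*-isND , refl) , Γ*-optimal) , Γ*-optimal Γ₀ nd₀
    where
    L≢[] : optimalPaths ≢ []
    L≢[] = let r , r∈ = nonempty-∈ ne in Any⇒≢[] (optimalPaths-cover Γ₀ nd₀ r∈)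
    Γ* : Tree k
    Γ* = pathTree optimalPaths L≢[]
    ∈paths⇒∈optimal : ∀ {p} → p ∈ paths Γ* → p ∈ optimalPaths
    ∈paths⇒∈optimal = subst (_ ∈_) (paths-pathTree optimalPaths L≢[])
    Γ*-isND : NDTreeFor T Γ*
    Γ*-isND =
        subst (All (_∈ᵥ attrs T)) (sym (attrsT-pathTree optimalPaths L≢[]))
          (concat⁺ (All-map⁺ (All.tabulate optimalPath-attrs)))
      , (λ r r∈ → subst (Any _) (sym (paths-pathTree optimalPaths L≢[]))
                          (optimalPaths-cover Γ₀ nd₀ r∈))
      , All.tabulate (optimalPath-correct ∘ ∈paths⇒∈optimal)
    Γ*-optimal : ∀ Γ → NDTreeFor T Γ → ψT ψ Γ* ≤ ψT ψ Γ
    Γ*-optimal Γ nd = ψT-lub ψ Γ* (optimalPath-cost Γ nd ∘ ∈paths⇒∈optimal)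

module _ {k : ℕ} (ψ : List ℕ → ℕ) where

  leafTree-isDet : ∀ {T : Table k} {d} → d ∈Π sub T [] → DetTreeFor T (leaf d ∷ [])
  leafTree-isDet {T} common = ([] , (λ r r∈ → here (sub⁺ T r∈ [])) , inj₂ common ∷ []) , refl , tt

  ψT-leafTree : ψ [] ≡ 0 → ∀ d → ψT ψ (leaf {k} d ∷ []) ≡ 0
  ψT-leafTree ψ[]≡0 d = trans (⊔-identityʳ (ψ [])) ψ[]≡0

  ψT≡0⇒common-decision : (∀ α → ψ α ≡ 0 → α ≡ []) → ∀ {T : Table k} Γ →
    NonEmptyT T → NDTreeFor T Γ → ψT ψ Γ ≡ 0 → ∃[ d ] d ∈Π sub T []
  ψT≡0⇒common-decision ψ≡0⇒[] {T} Γ ne nd ψT≡0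
    with r , r∈ ← nonempty-∈ ne
    with (α , d) , p∈ , _ , common ← deciding-path T Γ nd r∈
    with refl ← map-≡[] α (ψ≡0⇒[] _ (n≤0⇒n≡0 (≤-trans (ψT-path ψ Γ p∈) (≤-reflexive ψT≡0))))
    = d , common

  psiA≤0⇒psiD≡0 : IsPartiallyBounded ψ → ∀ {T : Table k} {a m} →
    PsiA ψ T a → a ≤ 0 → PsiD ψ T m → m ≡ 0
  psiA≤0⇒psiD≡0 _ _ _ (inj₁ (_ , m≡0)) = m≡0
  psiA≤0⇒psiD≡0 _ (inj₁ (no-rows , _)) _ (inj₂ (ne , _)) = ⊥-elim (ne no-rows)
  psiA≤0⇒psiD≡0 (ψ≡0⇒[] , ψ[]≡0 , _) (inj₂ (_ , (Γ , nd , refl) , _)) a≤0 (inj₂ (ne , _ , optimal))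
    with d , common ← ψT≡0⇒common-decision ψ≡0⇒[] Γ ne nd (n≤0⇒n≡0 a≤0)
    = n≤0⇒n≡0 (≤-trans (optimal _ (leafTree-isDet common)) (≤-reflexive (ψT-leafTree ψ[]≡0 d)))

  psiA≤psiD : IsPartiallyBounded ψ → ∀ {T : Table k} {m} → WF T → PsiD ψ T m →
    ∃[ a ] (PsiA ψ T a × a ≤ m)
  psiA≤psiD _ _ (inj₁ (no-rows , refl)) = 0 , inj₁ (no-rows , refl) , z≤n
  psiA≤psiD (_ , _ , ψ-↭ , ψ-++ , _) {T} (attrs-unique , _) (inj₂ (ne , (Γ , (nd , _) , refl) , _)) =
    psiA-attained Γ ne nd
    where open OptimalTree ψ ψ-↭ ψ-++ T attrs-unique

module _ {k : ℕ} (ψ : List ℕ → ℕ) (A : Table k → Set) where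

  HVal-mono : ∀ {n₁ n₂ h₁ h₂} → HVal ψ A n₁ h₁ → HVal ψ A n₂ h₂ → n₁ ≤ n₂ → h₁ ≤ h₂
  HVal-mono ((T , T∈A , (a , psiA , a≤n₁) , psiD) , _) (_ , maximal) n₁≤n₂ =
    maximal T T∈A a _ psiA (≤-trans a≤n₁ n₁≤n₂) psiD

  HVal-zero : IsPartiallyBounded ψ → ∀ {h} → HVal ψ A 0 h → h ≡ 0
  HVal-zero pb ((_ , _ , (_ , psiA , a≤0) , psiD) , _) = psiA≤0⇒psiD≡0 ψ pb psiA a≤0 psiD

  HVal-≤ : ∀ {c n h} → (∀ T → A T → ∀ m → PsiD ψ T m → m ≤ c) → HVal ψ A n h → h ≤ c
  HVal-≤ bound ((T , T∈A , _ , psiD) , _) = bound T T∈A _ psiD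

  psiD≤HVal : IsPartiallyBounded ψ → (∀ T → A T → WF T) →
    ∀ {T m h} → A T → PsiD ψ T m → HVal ψ A m h → m ≤ h
  psiD≤HVal pb wf {T} T∈A psiD (_ , maximal)
    with a , psiA , a≤m ← psiA≤psiD ψ pb (wf T T∈A) psiD = maximal T T∈A a _ psiA a≤m psiD

HD-below : (H : ℕ → ℕ) → (∀ {n₁ n₂} → n₁ ≤ n₂ → H n₁ ≤ H n₂) →
  (∀ c → ∃[ m ] (c < m × m ≤ H m)) →
  ∃[ d ] ((∀ i → d i < d (suc i)) × (∀ n v → HD d n v → v ≤ H n))
HD-below H H-mono above = d , (λ i → proj₁ (proj₂ (above (d i)))) , HD≤H
  where
  d : ℕ → ℕ
  d zero = proj₁ (above 0)
  d (suc i) = proj₁ (above (d i))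
  d≤H : ∀ i → d i ≤ H (d i)
  d≤H zero = proj₂ (proj₂ (above 0))
  d≤H (suc i) = proj₂ (proj₂ (above (d i)))
  HD≤H : ∀ n v → HD d n v → v ≤ H n
  HD≤H n v (inj₁ (_ , refl)) = z≤n
  HD≤H n v (inj₂ (i , dᵢ≤n , _ , refl)) = ≤-trans (d≤H i) (H-mono dᵢ≤n)

theorem2 : (k : ℕ) → 2 ≤ k → (ψ : List ℕ → ℕ) → IsBoundedMeasure ψ →
    (A : Table k → Set) → ClosedClass A → Nontrivial A →
    (def : ∀ n → ∃[ m ] HVal ψ A n m) →
    (∀ n₁ n₂ → n₁ ≤ n₂ → proj₁ (def n₁) ≤ proj₁ (def n₂)) ×
    proj₁ (def 0) ≡ 0 ×
    (PsiDBounded ψ A → ∃[ c ] (∀ n → proj₁ (def n) ≤ c)) ×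
    (PsiDUnbounded ψ A →
      ∃[ d ] ((∀ i → d i < d (suc i)) ×
        (∀ n v → HD d n v → v ≤ proj₁ (def n))))
theorem2 k _ ψ (pb , _) A (wf , _) _ def =
    (λ _ _ → H-mono)
  , HVal-zero ψ A pb (proj₂ (def 0))
  , (λ (c , bound) → c , λ n → HVal-≤ ψ A bound (proj₂ (def n)))
  , (λ unbounded → HD-below H H-mono (above unbounded))
  where
  H : ℕ → ℕ
  H n = proj₁ (def n)
  H-mono : ∀ {n₁ n₂} → n₁ ≤ n₂ → H n₁ ≤ H n₂
  H-mono {n₁} {n₂} = HVal-mono ψ A (proj₂ (def n₁)) (proj₂ (def n₂))
  above : PsiDUnbounded ψ A → ∀ c → ∃[ m ] (c < m × m ≤ H m)
  above unbounded c with T , T∈A , m , psiD , c<m ← unbounded c =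
    m , c<m , psiD≤HVal ψ A pb wf T∈A psiD (proj₂ (def m))
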